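{- Let $1\leq \ell \leq k$ and let $T$ be a tree isomorphic to $\Gamma_k$ with root $r$. Suppose that a non-empty subset of vertices of $T$ are marked. Then (1) $T$ contains a subdivision of $\Gamma_\ell$ all of whose leaves are marked, or (2) there exist a vertex $v\in V(T)$ and a child $w$ of $v$ such that $T_v$ contains at least one marked vertex, $T_w$ contains no marked vertex, and $w$ is at distance at most $\ell$ from $r$.
   Context: $\Gamma_k$ is the complete binary tree of height $k$ (rooted; every non-leaf vertex has two children; every root-to-leaf path has $k$ edges). For a vertex $v$ of a rooted tree $T$, $T_v$ denotes the subtree of $T$ rooted at $v$ (consisting of $v$ and its descendants). -}

module Defs where

open import Data.Bool using (Bool; true; false)
open import Data.List using (List; []; _∷_; _++_; [_]; length)
open import Data.Nat using (ℕ; _≤_; _<_)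
open import Data.Product using (Σ; ∃; _×_; _,_)
open import Data.Sum using (_⊎_)
open import Relation.Binary.PropositionalEquality using (_≡_)
open import Relation.Nullary using (¬_)

-- A vertex is its address: the list of left/right choices (false/true) on
-- the path from the root.  The depth (distance from the root) of v is
-- length v.
Addr : Set
Addr = List Bool

IsVertex : ℕ → Addr → Set
IsVertex k v = length v ≤ k

child : Addr → Bool → Addr
child v b = v ++ [ b ]

_≼_ : Addr → Addr → Set
v ≼ u = ∃ λ s → u ≡ v ++ s

-- A marking of the vertices of Γ_k (a subset, as a characteristic function;
-- values outside Γ_k are irrelevant).
Marking : Set
Marking = Addr → Bool

HasMarkedIn : ℕ → Marking → Addr → Set
HasMarkedIn k m v = ∃ λ u → IsVertex k u × v ≼ u × m u ≡ true

-- A subdivision of Γ_ℓ inside the rooted tree Γ_k is given by its branch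
-- vertices φ : V(Γ_ℓ) → V(Γ_k): for every internal vertex u of Γ_ℓ, the
-- images of its two children lie in the subtrees of the two distinct
-- children of φ(u) (then the connecting tree paths are internally disjoint
-- and form a subdivision of Γ_ℓ); the leaves of the subdivision are the
-- images of the leaves of Γ_ℓ.
record MarkedSubdivision (ℓ k : ℕ) (m : Marking) : Set where
  field
    φ        : Addr → Addr
    φ-vertex : ∀ u → IsVertex ℓ u → IsVertex k (φ u)
    φ-branch : ∀ u → length u < ℓ →
                 (child (φ u) false ≼ φ (child u false) × child (φ u) true ≼ φ (child u true))
               ⊎ (child (φ u) true ≼ φ (child u false) × child (φ u) false ≼ φ (child u true))
    φ-leaf   : ∀ u → length u ≡ ℓ → m (φ u) ≡ true

BadEdge : ℕ → ℕ → Marking → Set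
BadEdge ℓ k m = Σ Addr λ v → Σ Bool λ b →
    length v < k
  × HasMarkedIn k m v
  × ¬ HasMarkedIn k m (child v b)
  × length (child v b) ≤ ℓ

module Submission where

-- Call the vertex set of Γ_ℓ, i.e. the addresses of depth ≤ ℓ,
-- "covered" when every such vertex has a marked vertex of Γ_k below it.
--   * If the top ℓ levels are covered, Γ_k contains the required subdivision:
--     keep every internal vertex u of Γ_ℓ as its own branch vertex and send
--     every leaf u of Γ_ℓ to a marked descendant of u.
--   * Otherwise there is a bad edge.  Walking down from the root (which sees
--     a mark by hypothesis), either some child w of a vertex v that sees a
--     mark sees none itself -- a bad edge with depth w ≤ ℓ -- or both
--     children see marks and we continue below them.
-- Constructively the dichotomy needs "T_v contains a marked vertex" to be
-- decidable, which holds because T_v ∩ Γ_k is finite: we decide the bounded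
-- search "some extension of v of length ≤ n is marked" by recursion on n.

open import Defs
open import Data.Nat using (ℕ; _≤_)
open import Data.Product using (_×_)
open import Data.Sum using (_⊎_)
open import Data.List using ([])

open import Data.Bool using (Bool; true; false)
open import Data.Bool.Properties using () renaming (_≟_ to _≟ᵇ_)
open import Data.List using (_∷_; _++_; length)
open import Data.List.Properties using (length-++; ++-identityʳ; ∷ʳ-++)
open import Data.Nat using (zero; suc; _+_; _∸_; _<_; z≤n; s≤s)
open import Data.Nat.Properties
  using (+-comm; +-suc; ≤-refl; ≤-trans; ≤-reflexive; <-cmp; m+n≤o⇒m≤o;
         m+n≤o⇒m≤o∸n; m≤o∸n⇒m+n≤o)
open import Data.Product using (∃; _,_; proj₁; proj₂)
open import Data.Sum using (inj₁; inj₂; [_,_]′)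
open import Data.Empty using (⊥-elim)
open import Function using (_∘_)
open import Relation.Binary.Definitions using (tri<; tri≈; tri>)
open import Relation.Binary.PropositionalEquality using (_≡_; refl; sym; trans; cong; subst)
open import Relation.Nullary using (Dec; yes; no)
open import Relation.Nullary.Decidable using (map′; _⊎-dec_)

length-child : ∀ v b → length (child v b) ≡ suc (length v)
length-child v b = trans (length-++ v) (+-comm (length v) 1)

length-extend : ∀ (v s : Addr) → length (v ++ s) ≡ length s + length v
length-extend v s = trans (length-++ v) (+-comm (length v) (length s))

≼-refl : ∀ v → v ≼ v
≼-refl v = [] , sym (++-identityʳ v)

module Marks (k : ℕ) (m : Marking) where

  Marked : Addr → Set
  Marked u = m u ≡ true

  MarkedWithin : ℕ → Addr → Set
  MarkedWithin n v = ∃ λ s → length s ≤ n × Marked (v ++ s)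

  markedWithin-here : ∀ n v → Marked v → MarkedWithin n v
  markedWithin-here n v mv = [] , z≤n , subst Marked (sym (++-identityʳ v)) mv

  markedWithin-child : ∀ n v b → MarkedWithin n (child v b) → MarkedWithin (suc n) v
  markedWithin-child n v b (s , ls , mv) = b ∷ s , s≤s ls , subst Marked (∷ʳ-++ v b s) mv

  markedWithin-zero : ∀ v → MarkedWithin 0 v → Marked v
  markedWithin-zero v ([] , _ , mv) = subst Marked (++-identityʳ v) mv

  markedWithin-suc : ∀ n v →
    MarkedWithin (suc n) v → Marked v ⊎ (MarkedWithin n (child v false) ⊎ MarkedWithin n (child v true))
  markedWithin-suc n v ([]    , _ , mv)     = inj₁ (markedWithin-zero v ([] , z≤n , mv))
  markedWithin-suc n v (b ∷ s , s≤s ls , mv) = inj₂ (side b (s , ls , subst Marked (sym (∷ʳ-++ v b s)) mv))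
    where
    side : ∀ b → MarkedWithin n (child v b) → MarkedWithin n (child v false) ⊎ MarkedWithin n (child v true)
    side false = inj₁
    side true  = inj₂

  markedWithin? : ∀ n v → Dec (MarkedWithin n v)
  markedWithin? zero v =
    map′ (markedWithin-here 0 v) (markedWithin-zero v) (m v ≟ᵇ true)
  markedWithin? (suc n) v =
    map′ build (markedWithin-suc n v)
         (m v ≟ᵇ true ⊎-dec markedWithin? n (child v false) ⊎-dec markedWithin? n (child v true))
    where
    build : Marked v ⊎ (MarkedWithin n (child v false) ⊎ MarkedWithin n (child v true)) → MarkedWithin (suc n) v
    build (inj₁ mv)          = markedWithin-here (suc n) v mv
    build (inj₂ (inj₁ left))  = markedWithin-child n v false left
    build (inj₂ (inj₂ right)) = markedWithin-child n v true right

  hasMarkedIn? : ∀ v → IsVertex k v → Dec (HasMarkedIn k m v)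
  hasMarkedIn? v v∈Γk = map′ widen narrow (markedWithin? (k ∸ length v) v)
    where
    widen : MarkedWithin (k ∸ length v) v → HasMarkedIn k m v
    widen (s , ls , mv) =
      v ++ s , subst (_≤ k) (sym (length-extend v s)) (m≤o∸n⇒m+n≤o (length s) v∈Γk ls) , (s , refl) , mv
    narrow : HasMarkedIn k m v → MarkedWithin (k ∸ length v) v
    narrow (_ , u∈Γk , (s , refl) , mu) =
      s , m+n≤o⇒m≤o∸n (length s) (subst (_≤ k) (length-extend v s) u∈Γk) , mu

module Dichotomy (ℓ k : ℕ) (ℓ≤k : ℓ ≤ k) (m : Marking) where
  open Marks k m

  Covered : ℕ → Addr → Set
  Covered n v = ∀ s → length s ≤ n → HasMarkedIn k m (v ++ s)

  covered-zero : ∀ v → HasMarkedIn k m v → Covered 0 v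
  covered-zero v hv [] _ = subst (HasMarkedIn k m) (sym (++-identityʳ v)) hv

  covered-suc : ∀ n v → HasMarkedIn k m v →
    Covered n (child v false) → Covered n (child v true) → Covered (suc n) v
  covered-suc n v hv _     _     []          _          = subst (HasMarkedIn k m) (sym (++-identityʳ v)) hv
  covered-suc n v hv left  _     (false ∷ s) (s≤s ls) = subst (HasMarkedIn k m) (∷ʳ-++ v false s) (left s ls)
  covered-suc n v hv _     right (true ∷ s)  (s≤s ls) = subst (HasMarkedIn k m) (∷ʳ-++ v true s) (right s ls)

  covered-or-bad : ∀ n v → length v + n ≤ ℓ → HasMarkedIn k m v → BadEdge ℓ k m ⊎ Covered n v
  covered-or-bad zero    v _     hv = inj₂ (covered-zero v hv)
  covered-or-bad (suc n) v budget hv = glue (descend false) (descend true)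
    where
    child-budget : ∀ b → length (child v b) + n ≤ ℓ
    child-budget b =
      subst (_≤ ℓ) (trans (+-suc (length v) n) (cong (_+ n) (sym (length-child v b)))) budget
    child-depth : ∀ b → length (child v b) ≤ ℓ
    child-depth b = m+n≤o⇒m≤o (length (child v b)) (child-budget b)
    v-internal : length v < ℓ
    v-internal = subst (_≤ ℓ) (length-child v false) (child-depth false)
    descend : ∀ b → BadEdge ℓ k m ⊎ Covered n (child v b)
    descend b with hasMarkedIn? (child v b) (≤-trans (child-depth b) ℓ≤k)
    ... | no ¬hw = inj₁ (v , b , ≤-trans v-internal ℓ≤k , hv , ¬hw , child-depth b)
    ... | yes hw = covered-or-bad n (child v b) (child-budget b) hw
    glue : BadEdge ℓ k m ⊎ Covered n (child v false) → BadEdge ℓ k m ⊎ Covered n (child v true) →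
           BadEdge ℓ k m ⊎ Covered (suc n) v
    glue (inj₁ bad) _          = inj₁ bad
    glue (inj₂ _)   (inj₁ bad) = inj₁ bad
    glue (inj₂ c₀)  (inj₂ c₁)  = inj₂ (covered-suc n v hv c₀ c₁)

  module _ (covered : Covered ℓ []) where

    branch : Addr → Addr
    branch u with <-cmp (length u) ℓ
    ... | tri< _ _ _      = u
    ... | tri≈ _ u-leaf _ = proj₁ (covered u (≤-reflexive u-leaf))
    ... | tri> _ _ _      = u

    branch-internal : ∀ u → length u < ℓ → branch u ≡ u
    branch-internal u u-internal with <-cmp (length u) ℓ
    ... | tri< _ _ _     = refl
    ... | tri≈ ¬lt _ _   = ⊥-elim (¬lt u-internal)
    ... | tri> ¬lt _ _   = ⊥-elim (¬lt u-internal)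

    branch-below : ∀ u → u ≼ branch u
    branch-below u with <-cmp (length u) ℓ
    ... | tri< _ _ _      = ≼-refl u
    ... | tri≈ _ u-leaf _ = proj₁ (proj₂ (proj₂ (covered u (≤-reflexive u-leaf))))
    ... | tri> _ _ _      = ≼-refl u

    branch-vertex : ∀ u → IsVertex ℓ u → IsVertex k (branch u)
    branch-vertex u u∈Γℓ with <-cmp (length u) ℓ
    ... | tri< _ _ _      = ≤-trans u∈Γℓ ℓ≤k
    ... | tri≈ _ u-leaf _ = proj₁ (proj₂ (covered u (≤-reflexive u-leaf)))
    ... | tri> _ _ _      = ≤-trans u∈Γℓ ℓ≤k

    branch-leaf : ∀ u → length u ≡ ℓ → m (branch u) ≡ true
    branch-leaf u u-leaf with <-cmp (length u) ℓ
    ... | tri< _ ¬eq _    = ⊥-elim (¬eq u-leaf)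
    ... | tri≈ _ u-leaf′ _ = proj₂ (proj₂ (proj₂ (covered u (≤-reflexive u-leaf′))))
    ... | tri> _ ¬eq _    = ⊥-elim (¬eq u-leaf)

    branch-split : ∀ u → length u < ℓ →
        (child (branch u) false ≼ branch (child u false) × child (branch u) true ≼ branch (child u true))
      ⊎ (child (branch u) true ≼ branch (child u false) × child (branch u) false ≼ branch (child u true))
    branch-split u u-internal rewrite branch-internal u u-internal =
      inj₁ (branch-below (child u false) , branch-below (child u true))

    covered⇒subdivision : MarkedSubdivision ℓ k m
    covered⇒subdivision = record
      { φ        = branch
      ; φ-vertex = branch-vertex
      ; φ-branch = branch-split
      ; φ-leaf   = branch-leaf
      }

-- Lemma 5.3: run the dichotomy from the root with budget ℓ.
lemma5p3 : (ℓ k : ℕ) → 1 ≤ ℓ → ℓ ≤ k → (m : Marking) → HasMarkedIn k m [] →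
           MarkedSubdivision ℓ k m ⊎ BadEdge ℓ k m
lemma5p3 ℓ k _ ℓ≤k m root-marked =
  [ inj₂ , inj₁ ∘ covered⇒subdivision ]′ (covered-or-bad ℓ [] ≤-refl root-marked)
  where open Dichotomy ℓ k ℓ≤k m
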